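{- Let $K=(V,E)$ be a complete graph (clique) with $V=\{u_1,\ldots,u_n\}$ and threshold function $t:V\to\mathbb{N}_0$ such that, for some $0\le m\le n$, $$t(u_1)\le\cdots\le t(u_{n-m})<n\le t(u_{n-m+1})\le\cdots\le t(u_n).$$ Then Algorithm TSS on $(K,t)$ outputs an optimal target set (a target set of minimum cardinality among all target sets for $K$), and its size is $$m+\max_{1\le j\le n-m}\ \max\big(t(u_j)-m-j+1,\,0\big),$$ where the maximum over an empty range (when $m=n$) is taken to be $0$.
   Context: $\Gamma(v)$ is the neighborhood of $v$ and $d(v)=|\Gamma(v)|$. $\mathbb{N}_0=\{0,1,2,\ldots\}$. Activation process in a graph $H=(W,F)$ with thresholds $\tau:W\to\mathbb{N}_0$: for $S\subseteq W$, $\mathrm{Active}[S,0]=S$ and for $\ell\ge1$, $\mathrm{Active}[S,\ell]=\mathrm{Active}[S,\ell-1]\cup\{u\in W: |\Gamma(u)\cap \mathrm{Active}[S,\ell-1]|\ge \tau(u)\}$. $S$ is a target set if $\mathrm{Active}[S,\lambda]=W$ for some $\lambda\ge0$. Algorithm TSS on input $(G,t)$ with $G=(V,E)$: set $S=\emptyset$, $U=V$, and for each $v\in V$ set $\delta(v)=d(v)$, $k(v)=t(v)$, $N(v)=\Gamma(v)$. While $U\neq\emptyset$: (Case 1) if some $v\in U$ has $k(v)=0$, select such a $v$ and for each $u\in N(v)$ set $k(u)=\max(k(u)-1,0)$; (Case 2) otherwise, if some $v\in U$ has $\delta(v)<k(v)$, select such a $v$, set $S=S\cup\{v\}$, and for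 each $u\in N(v)$ set $k(u)=k(u)-1$; (Case 3) otherwise select $v\in\arg\max_{u\in U} \frac{k(u)}{\delta(u)(\delta(u)+1)}$. In every case, then, for each $u\in N(v)$ set $\delta(u)=\delta(u)-1$ and $N(u)=N(u)\setminus\{v\}$, and set $U=U\setminus\{v\}$. When $U=\emptyset$, output $S$. (When several vertices qualify for selection, the algorithm picks one of them; the choice rule is not specified.) -}

module Defs where

open import Data.Bool using (Bool; true; false; if_then_else_)
open import Data.Nat using (ℕ; zero; suc; _+_; _*_; _∸_; _≤_; _<_; _⊔_; _≤ᵇ_)
open import Data.Fin using (Fin; toℕ)
open import Data.Fin.Subset using (Subset; _∈_; _∉_; ⊤; ⁅_⁆; ∁; _∪_; _∩_; _-_; ∣_∣)
open import Data.Vec using (lookup; tabulate)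
open import Data.List using (List; foldr; map; allFin)
open import Data.Product using (Σ; ∃; _×_; _,_)
open import Relation.Binary.PropositionalEquality using (_≡_; _≢_)
open import Relation.Binary.Construct.Closure.ReflexiveTransitive using (Star)

-- A graph on vertex set Fin n is given by its neighbourhood function Γ.

clique : (n : ℕ) → Fin n → Subset n
clique n v = ∁ ⁅ v ⁆

Active : ∀ {n} → (Fin n → Subset n) → (Fin n → ℕ) → Subset n → ℕ → Subset n
Active Γ τ S zero = S
Active Γ τ S (suc ℓ) =
  Active Γ τ S ℓ ∪ tabulate (λ u → τ u ≤ᵇ ∣ Γ u ∩ Active Γ τ S ℓ ∣)

IsTargetSet : ∀ {n} → (Fin n → Subset n) → (Fin n → ℕ) → Subset n → Set
IsTargetSet Γ τ S = ∃ λ λ' → Active Γ τ S λ' ≡ ⊤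

IsOptimalTargetSet : ∀ {n} → (Fin n → Subset n) → (Fin n → ℕ) → Subset n → Set
IsOptimalTargetSet Γ τ S =
  IsTargetSet Γ τ S × (∀ S' → IsTargetSet Γ τ S' → ∣ S ∣ ≤ ∣ S' ∣)

-- Algorithm TSS (nondeterministic: a small-step relation on states)

record TSSState (n : ℕ) : Set where
  constructor mkState
  field
    S : Subset n
    U : Subset n
    δ : Fin n → ℕ
    k : Fin n → ℕ
    N : Fin n → Subset n
open TSSState public

initState : ∀ {n} → (Fin n → Subset n) → (Fin n → ℕ) → TSSState n
initState Γ t = mkState (Data.Fin.Subset.⊥) ⊤ (λ v → ∣ Γ v ∣) t Γ

remove : ∀ {n} → TSSState n → Fin n → Subset n → (Fin n → ℕ) → TSSState n
remove st v S' k' = mkState S' (U st - v)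
  (λ u → if lookup (N st v) u then δ st u ∸ 1 else δ st u)
  k'
  (λ u → if lookup (N st v) u then N st u - v else N st u)

decK : ∀ {n} → TSSState n → Fin n → Fin n → ℕ
decK st v u = if lookup (N st v) u then k st u ∸ 1 else k st u

data TSSStep {n : ℕ} : TSSState n → TSSState n → Set where
  case1 : ∀ st v → v ∈ U st → k st v ≡ 0 →
          TSSStep st (remove st v (S st) (decK st v))
  case2 : ∀ st v →
          (∀ u → u ∈ U st → k st u ≢ 0) →
          v ∈ U st → δ st v < k st v →
          TSSStep st (remove st v (S st ∪ ⁅ v ⁆) (decK st v))
  -- in Case 3, δ(u) ≥ k(u) ≥ 1 for all u ∈ U, so the comparison
  -- k(u)/(δ(u)(δ(u)+1)) ≤ k(v)/(δ(v)(δ(v)+1)) is done by cross-multiplying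
  case3 : ∀ st v →
          (∀ u → u ∈ U st → k st u ≢ 0) →
          (∀ u → u ∈ U st → k st u ≤ δ st u) →
          v ∈ U st →
          (∀ u → u ∈ U st →
             k st u * (δ st v * suc (δ st v)) ≤ k st v * (δ st u * suc (δ st u))) →
          TSSStep st (remove st v (S st) (k st))

TSSOutput : ∀ {n} → (Fin n → Subset n) → (Fin n → ℕ) → Subset n → Set
TSSOutput {n} Γ t out =
  Σ (TSSState n) λ st →
    Star TSSStep (initState Γ t) st × (∀ v → v ∉ U st) × S st ≡ out

-- The size formula  m + max_{1≤j≤n-m} max(t(u_j) - m - j + 1, 0)
-- written 0-indexed (i = j - 1): max over i < n - m of (t(i) ∸ m ∸ i);
-- empty maximum = 0.
cliqueBound : (n : ℕ) → (Fin n → ℕ) → ℕ → ℕ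
cliqueBound n t m =
  m + foldr _⊔_ 0
        (map (λ i → if suc (toℕ i) ≤ᵇ n ∸ m then t i ∸ m ∸ toℕ i else 0)
             (allFin n))

module Submission where

-- Everything is measured against y + |High y| − n (y ≤ n), where High y is
-- the set of vertices of threshold at least y.
--  * Lower bound (any graph): if all thresholds on B are ≥ y ≤ n, every
--    target set S' has y + |B| ≤ |S'| + n, since the first vertex of B ∖ S'
--    to activate sees at most |S'| + n − |B| active vertices.
--  * Runs on the clique: TSS keeps residual thresholds t ∸ c and residual
--    degrees |U| − 1, so every step is of one of three kinds.  Hence (a) a
--    budget invariant gives |S| ≤ K whenever all y + |High y| ≤ K + n, and
--    (b) the output is a target set, by activating the vertices backwards.
--  * Formula: K = m + F satisfies the hypothesis of (a), and the lower bound
--    on suffixes of the sorted order gives m + F ≤ |S'| for target sets S'.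

open import Defs
open import Data.Bool using (Bool; true; false; T; if_then_else_)
open import Data.Bool.Properties using (T-≡)
open import Data.Fin using (Fin; toℕ; fromℕ<) renaming (zero to fzero; suc to fsuc; _≟_ to _≟ᶠ_)
open import Data.Fin.Properties using (toℕ-fromℕ<; toℕ<n)
open import Data.Fin.Subset
open import Data.Fin.Subset.Properties
open import Data.List using (List; foldr; map; allFin) renaming ([] to []ₗ; _∷_ to _∷ₗ_)
open import Data.List.Membership.Propositional using () renaming (_∈_ to _∈ₗ_)
open import Data.List.Membership.Propositional.Properties using (∈-allFin)
open import Data.List.Relation.Unary.Any using () renaming (here to hereₗ; there to thereₗ)
open import Data.Nat using (ℕ; zero; suc; _+_; _*_; _∸_; _≤_; _<_; _≰_; _⊔_; _≤ᵇ_; z≤n; s≤s; _≤′_; ≤′-refl; ≤′-step)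
open import Data.Nat.Properties
open import Data.Product using (∃; _×_; _,_; proj₁; proj₂)
open import Data.Sum using (_⊎_; inj₁; inj₂)
import Data.Sum as Sum
open import Data.Vec using ([]; _∷_; lookup; tabulate; here; there)
open import Data.Vec.Properties using ([]=⇒lookup; lookup⇒[]=; lookup∘tabulate)
open import Function using (id)
open import Function.Bundles using (Equivalence)
open import Relation.Binary.Construct.Closure.ReflexiveTransitive using (Star; ε; _◅_)
open import Relation.Binary.PropositionalEquality
open import Relation.Nullary using (yes; no; contradiction)

open ≤-Reasoning

∈-tabulate⁻ : ∀ {n} (f : Fin n → Bool) {x : Fin n} → x ∈ tabulate f → T (f x)
∈-tabulate⁻ f {x} x∈ = Equivalence.from T-≡ (trans (sym (lookup∘tabulate f x)) ([]=⇒lookup x∈))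

∈-tabulate⁺ : ∀ {n} (f : Fin n → Bool) {x : Fin n} → T (f x) → x ∈ tabulate f
∈-tabulate⁺ f {x} fx = lookup⇒[]= x (tabulate f) (trans (lookup∘tabulate f x) (Equivalence.to T-≡ fx))

∈-≤ᵇ⁻ : ∀ {n} (f g : Fin n → ℕ) {x : Fin n} → x ∈ tabulate (λ u → f u ≤ᵇ g u) → f x ≤ g x
∈-≤ᵇ⁻ f g {x} x∈ = ≤ᵇ⇒≤ (f x) (g x) (∈-tabulate⁻ (λ u → f u ≤ᵇ g u) x∈)

∈-≤ᵇ⁺ : ∀ {n} (f g : Fin n → ℕ) {x : Fin n} → f x ≤ g x → x ∈ tabulate (λ u → f u ≤ᵇ g u)
∈-≤ᵇ⁺ f g le = ∈-tabulate⁺ (λ u → f u ≤ᵇ g u) (≤⇒≤ᵇ le)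

∈-remove⁻ : ∀ {n} {x y : Fin n} {p : Subset n} → x ∈ p - y → x ∈ p × x ≢ y
∈-remove⁻ {x = x} {y} {p} x∈ = p─q⊆p p ⁅ y ⁆ x∈ , λ x≡y → x∉p-x (subst (λ z → z ∈ p - y) x≡y x∈)
  where
  x∉p-x : ∀ {n} {x : Fin n} {p : Subset n} → x ∉ p - x
  x∉p-x {x = fzero} {s ∷ p} ()
  x∉p-x {x = fsuc x} {s ∷ p} (there x∈) = x∉p-x x∈

∈-clique⁺ : ∀ {n} {u v : Fin n} → u ≢ v → u ∈ clique n v
∈-clique⁺ u≢v = x∉p⇒x∈∁p (x≢y⇒x∉⁅y⁆ u≢v)

∣p∣≡1+∣p-x∣ : ∀ {n} {x : Fin n} {p : Subset n} → x ∈ p → ∣ p ∣ ≡ suc ∣ p - x ∣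
∣p∣≡1+∣p-x∣ {x = fzero} {true ∷ p} here = cong suc (cong ∣_∣ (sym (p─⊥≡p p)))
∣p∣≡1+∣p-x∣ {x = fsuc y} {true ∷ p} (there x∈) = cong suc (∣p∣≡1+∣p-x∣ x∈)
∣p∣≡1+∣p-x∣ {x = fsuc y} {false ∷ p} (there x∈) = ∣p∣≡1+∣p-x∣ x∈

∣p∪q∣≤∣p∣+∣q∣ : ∀ {n} (p q : Subset n) → ∣ p ∪ q ∣ ≤ ∣ p ∣ + ∣ q ∣
∣p∪q∣≤∣p∣+∣q∣ [] [] = z≤n
∣p∪q∣≤∣p∣+∣q∣ (true ∷ p) (true ∷ q) = s≤s (≤-trans (∣p∪q∣≤∣p∣+∣q∣ p q) (+-monoʳ-≤ ∣ p ∣ (n≤1+n _)))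
∣p∪q∣≤∣p∣+∣q∣ (true ∷ p) (false ∷ q) = s≤s (∣p∪q∣≤∣p∣+∣q∣ p q)
∣p∪q∣≤∣p∣+∣q∣ (false ∷ p) (true ∷ q) = ≤-trans (s≤s (∣p∪q∣≤∣p∣+∣q∣ p q)) (≤-reflexive (sym (+-suc _ _)))
∣p∪q∣≤∣p∣+∣q∣ (false ∷ p) (false ∷ q) = ∣p∪q∣≤∣p∣+∣q∣ p q

∣p∣≡∣p∩q∣+∣p∩∁q∣ : ∀ {n} (p q : Subset n) → ∣ p ∣ ≡ ∣ p ∩ q ∣ + ∣ p ∩ ∁ q ∣
∣p∣≡∣p∩q∣+∣p∩∁q∣ [] [] = refl
∣p∣≡∣p∩q∣+∣p∩∁q∣ (true ∷ p) (true ∷ q) = cong suc (∣p∣≡∣p∩q∣+∣p∩∁q∣ p q)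
∣p∣≡∣p∩q∣+∣p∩∁q∣ (true ∷ p) (false ∷ q) = trans (cong suc (∣p∣≡∣p∩q∣+∣p∩∁q∣ p q)) (sym (+-suc _ _))
∣p∣≡∣p∩q∣+∣p∩∁q∣ (false ∷ p) (true ∷ q) = ∣p∣≡∣p∩q∣+∣p∩∁q∣ p q
∣p∣≡∣p∩q∣+∣p∩∁q∣ (false ∷ p) (false ∷ q) = ∣p∣≡∣p∩q∣+∣p∩∁q∣ p q

empty⇒∣p∣≡0 : ∀ {n} (p : Subset n) → (∀ x → x ∉ p) → ∣ p ∣ ≡ 0
empty⇒∣p∣≡0 {n} p none = trans (cong ∣_∣ (Empty-unique (λ { (x , x∈) → none x x∈ }))) (∣⊥∣≡0 n)

⊆∪∁⇒∣p∣+∣r∣≤∣q∣+n : ∀ {n} {p q r : Subset n} → p ⊆ q ∪ ∁ r → ∣ p ∣ + ∣ r ∣ ≤ ∣ q ∣ + n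
⊆∪∁⇒∣p∣+∣r∣≤∣q∣+n {n} {p} {q} {r} p⊆ =
  ≤-trans (+-monoˡ-≤ ∣ r ∣ ∣p∣≤∣q∣+∣∁r∣) (≤-reflexive (trans (+-assoc (∣ q ∣) _ (∣ r ∣)) (cong (∣ q ∣ +_) ∣∁r∣+∣r∣≡n)))
  where
  ∣p∣≤∣q∣+∣∁r∣ : ∣ p ∣ ≤ ∣ q ∣ + ∣ ∁ r ∣
  ∣p∣≤∣q∣+∣∁r∣ = ≤-trans (p⊆q⇒∣p∣≤∣q∣ p⊆) (∣p∪q∣≤∣p∣+∣q∣ q (∁ r))
  ∣∁r∣+∣r∣≡n : ∣ ∁ r ∣ + ∣ r ∣ ≡ n
  ∣∁r∣+∣r∣≡n = trans (cong (_+ ∣ r ∣) (∣∁p∣≡n∸∣p∣ r)) (m∸n+n≡m (∣p∣≤n r))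

p-x∩q⊆p∩q : ∀ {n} (p q : Subset n) (x : Fin n) → (p - x) ∩ q ⊆ p ∩ q
p-x∩q⊆p∩q p q x w∈ with x∈p∩q⁻ (p - x) q w∈
... | w∈p-x , w∈q = x∈p∩q⁺ (proj₁ (∈-remove⁻ w∈p-x) , w∈q)

∣p-x∩q∣<∣p∩q∣ : ∀ {n} (p q : Subset n) {x : Fin n} → x ∈ p ∩ q → ∣ (p - x) ∩ q ∣ < ∣ p ∩ q ∣
∣p-x∩q∣<∣p∩q∣ p q {x} x∈ = ≤-trans (s≤s (p⊆q⇒∣p∣≤∣q∣ ⊆p∩q-x)) (≤-reflexive (sym (∣p∣≡1+∣p-x∣ x∈)))
  where
  ⊆p∩q-x : (p - x) ∩ q ⊆ (p ∩ q) - x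
  ⊆p∩q-x w∈ = x∈p∧x≢y⇒x∈p-y (p-x∩q⊆p∩q p q x w∈) (proj₂ (∈-remove⁻ (proj₁ (x∈p∩q⁻ (p - x) q w∈))))

atLeast : (n a : ℕ) → Subset n
atLeast zero a = []
atLeast (suc n) zero = ⊤
atLeast (suc n) (suc a) = false ∷ atLeast n a

∣atLeast∣ : ∀ n a → ∣ atLeast n a ∣ ≡ n ∸ a
∣atLeast∣ zero a = sym (0∸n≡0 a)
∣atLeast∣ (suc n) zero = ∣⊤∣≡n (suc n)
∣atLeast∣ (suc n) (suc a) = ∣atLeast∣ n a

∈atLeast⁻ : ∀ n a (j : Fin n) → j ∈ atLeast n a → a ≤ toℕ j
∈atLeast⁻ (suc n) zero j j∈ = z≤n
∈atLeast⁻ (suc n) (suc a) (fsuc j) (there j∈) = s≤s (∈atLeast⁻ n a j j∈)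

∈atLeast⁺ : ∀ n a (j : Fin n) → a ≤ toℕ j → j ∈ atLeast n a
∈atLeast⁺ (suc n) zero j a≤j = ∈⊤
∈atLeast⁺ (suc n) (suc a) (fsuc j) (s≤s a≤j) = there (∈atLeast⁺ n a j a≤j)

-- An upward closed subset of Fin n with at least n ∸ i elements contains i:
-- otherwise it would lie inside {i+1, …, n−1}.
upClosed-∋ : ∀ {n} (P : Subset n) → (∀ j j' → toℕ j ≤ toℕ j' → j ∈ P → j' ∈ P) →
             (i : Fin n) → n ∸ toℕ i ≤ ∣ P ∣ → i ∈ P
upClosed-∋ {n} P upward i large with i ∈? P
... | yes i∈P = i∈P
... | no i∉P = contradiction large (<⇒≱ (begin-strict
  (∣ P ∣)                       ≤⟨ p⊆q⇒∣p∣≤∣q∣ P⊆ ⟩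
  (∣ atLeast n (suc (toℕ i)) ∣) ≡⟨ ∣atLeast∣ n (suc (toℕ i)) ⟩
  n ∸ suc (toℕ i)               <⟨ ∸-monoʳ-< (n<1+n (toℕ i)) (toℕ<n i) ⟩
  n ∸ toℕ i                     ∎))
  where
  P⊆ : P ⊆ atLeast n (suc (toℕ i))
  P⊆ {j} j∈P with toℕ j ≤? toℕ i
  ... | yes j≤i = contradiction (upward j i j≤i j∈P) i∉P
  ... | no j≰i = ∈atLeast⁺ n (suc (toℕ i)) j (≰⇒> j≰i)

∸-≤-shift : ∀ {a i n s} → i ≤ n → a + (n ∸ i) ≤ s + n → a ∸ i ≤ s
∸-≤-shift {a} {i} {n} {s} i≤n le = m≤n+o⇒m∸n≤o a i (+-cancelʳ-≤ (n ∸ i) a (i + s) (begin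
  a + (n ∸ i)        ≤⟨ le ⟩
  s + n              ≡⟨ cong (s +_) (sym (m+[n∸m]≡n i≤n)) ⟩
  s + (i + (n ∸ i))  ≡⟨ sym (+-assoc s i (n ∸ i)) ⟩
  s + i + (n ∸ i)    ≡⟨ cong (_+ (n ∸ i)) (+-comm s i) ⟩
  i + s + (n ∸ i)    ∎))

+∸-≤-shift : ∀ a {i n} → i ≤ n → a + (n ∸ i) ≤ (a ∸ i) + n
+∸-≤-shift a {i} {n} i≤n = begin
  a + (n ∸ i)              ≤⟨ +-monoˡ-≤ (n ∸ i) (m≤n+m∸n a i) ⟩
  i + (a ∸ i) + (n ∸ i)    ≡⟨ cong (_+ (n ∸ i)) (+-comm i (a ∸ i)) ⟩
  (a ∸ i) + i + (n ∸ i)    ≡⟨ +-assoc (a ∸ i) i (n ∸ i) ⟩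
  (a ∸ i) + (i + (n ∸ i))  ≡⟨ cong ((a ∸ i) +_) (m+[n∸m]≡n i≤n) ⟩
  (a ∸ i) + n              ∎

+-suc-inner : ∀ s y a → suc s + (y + a) ≡ s + (y + suc a)
+-suc-inner s y a = trans (sym (+-suc s (y + a))) (cong (s +_) (sym (+-suc y a)))

∸-swap : ∀ a b c → a ∸ b ∸ c ≡ a ∸ c ∸ b
∸-swap a b c = begin-equality
  a ∸ b ∸ c    ≡⟨ ∸-+-assoc a b c ⟩
  a ∸ (b + c)  ≡⟨ cong (a ∸_) (+-comm b c) ⟩
  a ∸ (c + b)  ≡⟨ ∸-+-assoc a c b ⟨
  a ∸ c ∸ b    ∎

fold⊔-lub : ∀ {A : Set} (f : A → ℕ) (xs : List A) b → (∀ x → f x ≤ b) → foldr _⊔_ 0 (map f xs) ≤ b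
fold⊔-lub f []ₗ b bound = z≤n
fold⊔-lub f (x ∷ₗ xs) b bound = ⊔-lub (bound x) (fold⊔-lub f xs b bound)

fold⊔-ub : ∀ {A : Set} (f : A → ℕ) (xs : List A) {x} → x ∈ₗ xs → f x ≤ foldr _⊔_ 0 (map f xs)
fold⊔-ub f (x ∷ₗ xs) (hereₗ refl) = m≤m⊔n (f x) _
fold⊔-ub f (x ∷ₗ xs) (thereₗ x∈) = ≤-trans (fold⊔-ub f xs x∈) (m≤n⊔m (f x) _)

module Activation {n : ℕ} (Γ : Fin n → Subset n) (τ : Fin n → ℕ) (S₀ : Subset n) where
  A : ℕ → Subset n
  A = Active Γ τ S₀

  A-mono : ∀ {ℓ ℓ'} → ℓ ≤ ℓ' → A ℓ ⊆ A ℓ'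
  A-mono ℓ≤ℓ' = go (≤⇒≤′ ℓ≤ℓ')
    where
    go : ∀ {ℓ ℓ'} → ℓ ≤′ ℓ' → A ℓ ⊆ A ℓ'
    go ≤′-refl x∈ = x∈
    go (≤′-step ℓ≤ℓ') x∈ = p⊆p∪q _ (go ℓ≤ℓ' x∈)

  A-step : ∀ ℓ u → τ u ≤ ∣ Γ u ∩ A ℓ ∣ → u ∈ A (suc ℓ)
  A-step ℓ u enough = x∈p∪q⁺ (inj₂ (∈-≤ᵇ⁺ τ (λ w → ∣ Γ w ∩ A ℓ ∣) enough))

  A-inv : ∀ ℓ u → u ∈ A (suc ℓ) → u ∈ A ℓ ⊎ τ u ≤ ∣ Γ u ∩ A ℓ ∣
  A-inv ℓ u u∈ = Sum.map₂ (∈-≤ᵇ⁻ τ (λ w → ∣ Γ w ∩ A ℓ ∣)) (x∈p∪q⁻ (A ℓ) _ u∈)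

module LowerBound {n : ℕ} (Γ : Fin n → Subset n) (τ : Fin n → ℕ) (S' : Subset n)
                  (y : ℕ) (B : Subset n) (B-high : ∀ u → u ∈ B → y ≤ τ u) where
  open Activation Γ τ S'

  -- If the bound fails, the vertices of B outside S' are never activated:
  -- the first one would see at most |A ℓ| ≤ |S'| + n − |B| active vertices.
  B-inert : y + ∣ B ∣ ≰ ∣ S' ∣ + n → ∀ ℓ → A ℓ ⊆ S' ∪ ∁ B
  B-inert ¬bound zero u∈ = x∈p∪q⁺ (inj₁ u∈)
  B-inert ¬bound (suc ℓ) {u} u∈ with A-inv ℓ u u∈ | u ∈? B
  ... | inj₁ u∈A | _ = B-inert ¬bound ℓ u∈A
  ... | inj₂ _ | no u∉B = x∈p∪q⁺ (inj₂ (x∉p⇒x∈∁p u∉B))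
  ... | inj₂ enough | yes u∈B = contradiction bound ¬bound
    where
    bound : y + ∣ B ∣ ≤ ∣ S' ∣ + n
    bound = ≤-trans (+-monoˡ-≤ ∣ B ∣ (≤-trans (B-high u u∈B) (≤-trans enough (∣p∩q∣≤∣q∣ (Γ u) (A ℓ)))))
                    (⊆∪∁⇒∣p∣+∣r∣≤∣q∣+n (B-inert ¬bound ℓ))

  -- Otherwise all of B, being eventually active, lies in S'.
  targetSet-lowerBound : IsTargetSet Γ τ S' → y ≤ n → y + ∣ B ∣ ≤ ∣ S' ∣ + n
  targetSet-lowerBound (λ' , A≡⊤) y≤n with y + ∣ B ∣ ≤? ∣ S' ∣ + n
  ... | yes bound = bound
  ... | no ¬bound = begin
    y + (∣ B ∣)    ≤⟨ +-mono-≤ y≤n (p⊆q⇒∣p∣≤∣q∣ B⊆S') ⟩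
    n + (∣ S' ∣)   ≡⟨ +-comm n (∣ S' ∣) ⟩
    (∣ S' ∣) + n   ∎
    where
    B⊆S' : B ⊆ S'
    B⊆S' {u} u∈B with x∈p∪q⁻ S' (∁ B) (B-inert ¬bound λ' (subst (u ∈_) (sym A≡⊤) ∈⊤))
    ... | inj₁ u∈S' = u∈S'
    ... | inj₂ u∈∁B = contradiction u∈B (x∈∁p⇒x∉p u∈∁B)

High : ∀ {n} → (Fin n → ℕ) → ℕ → Subset n
High t y = tabulate (λ u → y ≤ᵇ t u)

∈High⁻ : ∀ {n} (t : Fin n → ℕ) y {u} → u ∈ High t y → y ≤ t u
∈High⁻ t y = ∈-≤ᵇ⁻ (λ _ → y) t

∈High⁺ : ∀ {n} (t : Fin n → ℕ) y {u} → y ≤ t u → u ∈ High t y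
∈High⁺ t y = ∈-≤ᵇ⁺ (λ _ → y) t

module CliqueRun (n : ℕ) (t : Fin n → ℕ) where

  -- Invariant after c vertices have been removed in Cases 1–2 (the vertices
  -- every remaining vertex counts as active): residual thresholds are t ∸ c,
  -- residual degrees are |U| − 1, and remaining vertices still see each other.
  record Invariant (st : TSSState n) (c : ℕ) : Set where
    field
      k≡ : ∀ u → u ∈ U st → k st u ≡ t u ∸ c
      δ≡ : ∀ u → u ∈ U st → δ st u ≡ ∣ U st ∣ ∸ 1
      N⊇ : ∀ u w → u ∈ U st → w ∈ U st → w ≢ u → w ∈ N st u
  open Invariant

  invariant-init : Invariant (initState (clique n) t) 0
  k≡ invariant-init u _ = refl
  δ≡ invariant-init u _ = trans (∣∁p∣≡n∸∣p∣ ⁅ u ⁆) (cong₂ _∸_ (sym (∣⊤∣≡n n)) (∣⁅x⁆∣≡1 u))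
  N⊇ invariant-init u w _ _ w≢u = ∈-clique⁺ w≢u

  private
    N-lookup : ∀ {st c} v u → Invariant st c → v ∈ U st → u ∈ U st - v → lookup (N st v) u ≡ true
    N-lookup v u I v∈ u∈ = []=⇒lookup (N⊇ I v u v∈ (proj₁ (∈-remove⁻ u∈)) (proj₂ (∈-remove⁻ u∈)))

    if-true : ∀ {A : Set} {b} {x y : A} → b ≡ true → (if b then x else y) ≡ x
    if-true refl = refl

  invariant-remove : ∀ {st c c'} v S' k' → Invariant st c → v ∈ U st →
    (∀ u → u ∈ U st - v → k' u ≡ t u ∸ c') → Invariant (remove st v S' k') c'
  k≡ (invariant-remove v S' k' I v∈ k'≡) = k'≡
  δ≡ (invariant-remove {st} v S' k' I v∈ k'≡) u u∈ = begin-equality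
    (if lookup (N st v) u then δ st u ∸ 1 else δ st u)  ≡⟨ if-true (N-lookup v u I v∈ u∈) ⟩
    δ st u ∸ 1                                          ≡⟨ cong (_∸ 1) (δ≡ I u (proj₁ (∈-remove⁻ u∈))) ⟩
    ∣ U st ∣ ∸ 1 ∸ 1                                    ≡⟨ cong (λ z → z ∸ 1 ∸ 1) (∣p∣≡1+∣p-x∣ v∈) ⟩
    ∣ U st - v ∣ ∸ 1                                    ∎
  N⊇ (invariant-remove v S' k' I v∈ k'≡) u w u∈ w∈ w≢u =
    subst (w ∈_) (sym (if-true (N-lookup v u I v∈ u∈)))
      (x∈p∧x≢y⇒x∈p-y (N⊇ I u w (proj₁ (∈-remove⁻ u∈)) (proj₁ (∈-remove⁻ w∈)) w≢u) (proj₂ (∈-remove⁻ w∈)))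

  decK≡ : ∀ {st c} v → Invariant st c → v ∈ U st → ∀ u → u ∈ U st - v → decK st v u ≡ t u ∸ suc c
  decK≡ {st} {c} v I v∈ u u∈ = begin-equality
    decK st v u      ≡⟨ if-true (N-lookup v u I v∈ u∈) ⟩
    k st u ∸ 1       ≡⟨ cong (_∸ 1) (k≡ I u (proj₁ (∈-remove⁻ u∈))) ⟩
    t u ∸ c ∸ 1      ≡⟨ ∸-+-assoc (t u) c 1 ⟩
    t u ∸ (c + 1)    ≡⟨ cong (t u ∸_) (+-comm c 1) ⟩
    t u ∸ suc c      ∎

  data Step (st st' : TSSState n) (c : ℕ) : Set where
    activated : ∀ v → v ∈ U st → t v ≤ c → U st' ≡ U st - v → S st' ≡ S st →
                Invariant st' (suc c) → Step st st' c
    selected : ∀ v → v ∈ U st → ∣ U st ∣ + c ≤ t v → U st' ≡ U st - v →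
               S st' ≡ S st ∪ ⁅ v ⁆ → Invariant st' (suc c) → Step st st' c
    deferred : ∀ v → v ∈ U st → t v < ∣ U st ∣ + c → (∀ u → u ∈ U st - v → t u ≤ t v) →
               U st' ≡ U st - v → S st' ≡ S st → Invariant st' c → Step st st' c

  -- Case 2 selects v exactly when δ(v) < k(v), i.e. |U| − 1 < t v ∸ c.
  selected-threshold : ∀ {st c} v → Invariant st c → (∀ u → u ∈ U st → k st u ≢ 0) →
    v ∈ U st → δ st v < k st v → ∣ U st ∣ + c ≤ t v
  selected-threshold {st} {c} v I nonzero v∈ δ<k = begin
    (∣ U st ∣) + c         ≡⟨ cong (_+ c) (∣p∣≡1+∣p-x∣ v∈) ⟩
    suc ∣ U st - v ∣ + c   ≤⟨ +-monoˡ-≤ c (subst₂ _<_ δv≡ (k≡ I v v∈) δ<k) ⟩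
    t v ∸ c + c            ≡⟨ m∸n+n≡m (<⇒≤ (m∸n≢0⇒n<m {t v} {c} (λ eq → nonzero v v∈ (trans (k≡ I v v∈) eq)))) ⟩
    t v                    ∎
    where
    δv≡ : δ st v ≡ ∣ U st - v ∣
    δv≡ = trans (δ≡ I v v∈) (cong (_∸ 1) (∣p∣≡1+∣p-x∣ v∈))

  -- In Case 3 all residual degrees are equal, so maximising
  -- k/(δ(δ+1)) maximises t, and k(v) ≤ δ(v) gives t v < |U| + c.
  module Deferred {st c} v (I : Invariant st c)
    (nonzero : ∀ u → u ∈ U st → k st u ≢ 0) (k≤δ : ∀ u → u ∈ U st → k st u ≤ δ st u)
    (v∈ : v ∈ U st)
    (maximal : ∀ u → u ∈ U st → k st u * (δ st v * suc (δ st v)) ≤ k st v * (δ st u * suc (δ st u))) where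

    δ≡d : ∀ u → u ∈ U st → δ st u ≡ ∣ U st - v ∣
    δ≡d u u∈ = trans (δ≡ I u u∈) (cong (_∸ 1) (∣p∣≡1+∣p-x∣ v∈))

    c≤t : ∀ u → u ∈ U st → c ≤ t u
    c≤t u u∈ = <⇒≤ (m∸n≢0⇒n<m {t u} {c} (λ eq → nonzero u u∈ (trans (k≡ I u u∈) eq)))

    threshold : t v < ∣ U st ∣ + c
    threshold = begin-strict
      t v                    ≡⟨ m∸n+n≡m (c≤t v v∈) ⟨
      t v ∸ c + c            ≤⟨ +-monoˡ-≤ c (subst₂ _≤_ (k≡ I v v∈) (δ≡d v v∈) (k≤δ v v∈)) ⟩
      ∣ U st - v ∣ + c        <⟨ s≤s ≤-refl ⟩
      suc ∣ U st - v ∣ + c    ≡⟨ cong (_+ c) (∣p∣≡1+∣p-x∣ v∈) ⟨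
      (∣ U st ∣) + c         ∎

    max-threshold : ∀ u → u ∈ U st - v → t u ≤ t v
    max-threshold u u∈ with ∣ U st - v ∣ in d≡ | δ≡d u (proj₁ (∈-remove⁻ u∈)) | δ≡d v v∈
    ... | zero | _ | _ = contradiction (sym d≡) (<⇒≢ (≤-<-trans z≤n (x∈p⇒∣p-x∣<∣p∣ u∈)))
    ... | suc d | δu≡ | δv≡ = begin
      t u            ≡⟨ m∸n+n≡m (c≤t u (proj₁ (∈-remove⁻ u∈))) ⟨
      t u ∸ c + c    ≤⟨ +-monoˡ-≤ c (*-cancelʳ-≤ (t u ∸ c) (t v ∸ c) (suc d * suc (suc d)) cross) ⟩
      t v ∸ c + c    ≡⟨ m∸n+n≡m (c≤t v v∈) ⟩
      t v            ∎
      where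
      cross : (t u ∸ c) * (suc d * suc (suc d)) ≤ (t v ∸ c) * (suc d * suc (suc d))
      cross = subst₂ _≤_ (cong₂ (λ a b → a * (b * suc b)) (k≡ I u (proj₁ (∈-remove⁻ u∈))) δv≡)
                         (cong₂ (λ a b → a * (b * suc b)) (k≡ I v v∈) δu≡)
                         (maximal u (proj₁ (∈-remove⁻ u∈)))

  classify : ∀ {st st' c} → Invariant st c → TSSStep st st' → Step st st' c
  classify I (case1 st v v∈ k≡0) =
    activated v v∈ (m∸n≡0⇒m≤n (trans (sym (k≡ I v v∈)) k≡0)) refl refl
      (invariant-remove v (S st) (decK st v) I v∈ (decK≡ v I v∈))
  classify I (case2 st v nonzero v∈ δ<k) =
    selected v v∈ (selected-threshold v I nonzero v∈ δ<k) refl refl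
      (invariant-remove v _ (decK st v) I v∈ (decK≡ v I v∈))
  classify I (case3 st v nonzero k≤δ v∈ maximal) =
    deferred v v∈ threshold max-threshold refl refl
      (invariant-remove v (S st) (k st) I v∈ (λ u u∈ → k≡ I u (proj₁ (∈-remove⁻ u∈))))
    where open Deferred v I nonzero k≤δ v∈ maximal

  S-mono : ∀ {st st' : TSSState n} → Star TSSStep st st' → S st ⊆ S st'
  S-mono ε x∈ = x∈
  S-mono (case1 st v _ _ ◅ run) x∈ = S-mono run x∈
  S-mono (case2 st v _ _ _ ◅ run) x∈ = S-mono run (p⊆p∪q ⁅ v ⁆ x∈)
  S-mono (case3 st v _ _ _ _ ◅ run) x∈ = S-mono run x∈

  module UpperBound (K : ℕ) (high-bound : ∀ y → y ≤ n → y + ∣ High t y ∣ ≤ K + n) where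

    Budget : Subset n → Subset n → ℕ → Set
    Budget Us Ss c = ∀ y → c ≤ y → y ≤ ∣ Us ∣ + c → ∣ Ss ∣ + (y + ∣ Us ∩ High t y ∣) ≤ K + (∣ Us ∣ + c)

    budget-init : Budget ⊤ ⊥ 0
    budget-init y _ y≤ = begin
      (∣ ⊥ {n} ∣) + (y + ∣ ⊤ ∩ High t y ∣)  ≡⟨ cong (_+ (y + ∣ ⊤ ∩ High t y ∣)) (∣⊥∣≡0 n) ⟩
      y + (∣ ⊤ ∩ High t y ∣)               ≤⟨ +-monoʳ-≤ y (∣p∩q∣≤∣q∣ ⊤ (High t y)) ⟩
      y + (∣ High t y ∣)                   ≤⟨ high-bound y (≤-trans y≤ (≤-reflexive n≡)) ⟩
      K + n                                ≡⟨ cong (K +_) n≡ ⟨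
      K + (∣ ⊤ {n} ∣ + 0)                   ∎
      where
      n≡ : ∣ ⊤ {n} ∣ + 0 ≡ n
      n≡ = trans (+-identityʳ _) (∣⊤∣≡n n)

    -- At the level y = |Us| + c the budget bounds the selected set itself.
    budget-size : ∀ {Us Ss c} → Budget Us Ss c → ∣ Ss ∣ ≤ K
    budget-size {Us} {Ss} {c} budget = +-cancelʳ-≤ r (∣ Ss ∣) K (begin
      (∣ Ss ∣) + r                          ≤⟨ +-monoʳ-≤ ∣ Ss ∣ (m≤m+n r _) ⟩
      (∣ Ss ∣) + (r + ∣ Us ∩ High t r ∣)    ≤⟨ budget r (m≤n+m c _) ≤-refl ⟩
      K + r                                 ∎)
      where
      r : ℕ
      r = ∣ Us ∣ + c

    private
      shift : ∀ {Us : Subset n} {v} c → v ∈ Us → ∣ Us ∣ + c ≡ ∣ Us - v ∣ + suc c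
      shift c v∈ = trans (cong (_+ c) (∣p∣≡1+∣p-x∣ v∈)) (sym (+-suc _ c))

    -- Case 1 moves one unit from |U| to c and selects nothing.
    budget-activated : ∀ {Us Ss c v} → v ∈ Us → Budget Us Ss c → Budget (Us - v) Ss (suc c)
    budget-activated {Us} {Ss} {c} {v} v∈ budget y c<y y≤ = begin
      (∣ Ss ∣) + (y + a)                    ≤⟨ +-monoʳ-≤ ∣ Ss ∣ (+-monoʳ-≤ y (p⊆q⇒∣p∣≤∣q∣ (p-x∩q⊆p∩q Us (High t y) v))) ⟩
      (∣ Ss ∣) + (y + ∣ Us ∩ High t y ∣)    ≤⟨ budget y (<⇒≤ c<y) (≤-trans y≤ (≤-reflexive (sym (shift c v∈)))) ⟩
      K + (∣ Us ∣ + c)                      ≡⟨ cong (K +_) (shift c v∈) ⟩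
      K + (∣ Us - v ∣ + suc c)              ∎
      where
      a : ℕ
      a = ∣ (Us - v) ∩ High t y ∣

    -- Case 2 selects v, paid for by v leaving the remaining high vertices.
    budget-selected : ∀ {Us Ss c v} → v ∈ Us → ∣ Us ∣ + c ≤ t v →
      Budget Us Ss c → Budget (Us - v) (Ss ∪ ⁅ v ⁆) (suc c)
    budget-selected {Us} {Ss} {c} {v} v∈ high budget y c<y y≤ = begin
      (∣ Ss ∪ ⁅ v ⁆ ∣) + (y + a)             ≤⟨ +-monoˡ-≤ (y + a) one-more ⟩
      suc (∣ Ss ∣) + (y + a)                 ≡⟨ +-suc-inner (∣ Ss ∣) y a ⟩
      (∣ Ss ∣) + (y + suc a)                 ≤⟨ +-monoʳ-≤ ∣ Ss ∣ (+-monoʳ-≤ y (∣p-x∩q∣<∣p∩q∣ Us (High t y) v∈UH)) ⟩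
      (∣ Ss ∣) + (y + ∣ Us ∩ High t y ∣)     ≤⟨ budget y (<⇒≤ c<y) y≤old ⟩
      K + (∣ Us ∣ + c)                       ≡⟨ cong (K +_) (shift c v∈) ⟩
      K + (∣ Us - v ∣ + suc c)               ∎
      where
      a : ℕ
      a = ∣ (Us - v) ∩ High t y ∣
      y≤old : y ≤ ∣ Us ∣ + c
      y≤old = ≤-trans y≤ (≤-reflexive (sym (shift c v∈)))
      v∈UH : v ∈ Us ∩ High t y
      v∈UH = x∈p∩q⁺ (v∈ , ∈High⁺ t y (≤-trans y≤old high))
      one-more : ∣ Ss ∪ ⁅ v ⁆ ∣ ≤ suc ∣ Ss ∣
      one-more = ≤-trans (∣p∪q∣≤∣p∣+∣q∣ Ss ⁅ v ⁆) (≤-reflexive (trans (cong (∣ Ss ∣ +_) (∣⁅x⁆∣≡1 v)) (+-comm _ 1)))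

    private
      shrink : ∀ {Us : Subset n} {v} c → v ∈ Us → ∣ Us ∣ + c ≡ suc (∣ Us - v ∣ + c)
      shrink c v∈ = cong (_+ c) (∣p∣≡1+∣p-x∣ v∈)

      shrink-K : ∀ {Us : Subset n} {v} c → v ∈ Us → K + (∣ Us ∣ + c) ≡ suc (K + (∣ Us - v ∣ + c))
      shrink-K c v∈ = trans (cong (K +_) (shrink c v∈)) (+-suc K _)

    -- Case 3 discards a vertex v of maximal threshold.  At a level y ≤ t v,
    -- v was counted among the remaining high vertices ...
    budget-deferred-counted : ∀ {Us Ss c v} → v ∈ Us → Budget Us Ss c →
      ∀ y → c ≤ y → y ≤ ∣ Us - v ∣ + c → y ≤ t v →
      ∣ Ss ∣ + (y + ∣ (Us - v) ∩ High t y ∣) ≤ K + (∣ Us - v ∣ + c)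
    budget-deferred-counted {Us} {Ss} {c} {v} v∈ budget y c≤y y≤ y≤tv = ≤-pred (begin
      suc (∣ Ss ∣) + (y + a)                 ≡⟨ +-suc-inner (∣ Ss ∣) y a ⟩
      (∣ Ss ∣) + (y + suc a)                 ≤⟨ +-monoʳ-≤ ∣ Ss ∣ (+-monoʳ-≤ y (∣p-x∩q∣<∣p∩q∣ Us (High t y) v∈UH)) ⟩
      (∣ Ss ∣) + (y + ∣ Us ∩ High t y ∣)     ≤⟨ budget y c≤y (≤-trans y≤ (≤-trans (n≤1+n _) (≤-reflexive (sym (shrink c v∈))))) ⟩
      K + (∣ Us ∣ + c)                       ≡⟨ shrink-K c v∈ ⟩
      suc (K + (∣ Us - v ∣ + c))             ∎)
      where
      a : ℕ
      a = ∣ (Us - v) ∩ High t y ∣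
      v∈UH : v ∈ Us ∩ High t y
      v∈UH = x∈p∩q⁺ (v∈ , ∈High⁺ t y y≤tv)

    -- ... and at a level y > t v no remaining vertex is high, so the budget
    -- at level y + 1 applies.
    budget-deferred-skipped : ∀ {Us Ss c v} → v ∈ Us → (∀ u → u ∈ Us - v → t u ≤ t v) →
      Budget Us Ss c → ∀ y → c ≤ y → y ≤ ∣ Us - v ∣ + c → y ≰ t v →
      ∣ Ss ∣ + (y + ∣ (Us - v) ∩ High t y ∣) ≤ K + (∣ Us - v ∣ + c)
    budget-deferred-skipped {Us} {Ss} {c} {v} v∈ maximal budget y c≤y y≤ y≰tv = ≤-pred (begin
      suc (∣ Ss ∣) + (y + a)                 ≡⟨ cong (λ z → suc (∣ Ss ∣) + (y + z)) none-high ⟩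
      suc (∣ Ss ∣) + (y + 0)                 ≡⟨ +-suc (∣ Ss ∣) (y + 0) ⟨
      (∣ Ss ∣) + (suc y + 0)                 ≤⟨ +-monoʳ-≤ ∣ Ss ∣ (+-monoʳ-≤ (suc y) z≤n) ⟩
      (∣ Ss ∣) + (suc y + ∣ Us ∩ High t (suc y) ∣)
                                             ≤⟨ budget (suc y) (m≤n⇒m≤1+n c≤y) (≤-trans (s≤s y≤) (≤-reflexive (sym (shrink c v∈)))) ⟩
      K + (∣ Us ∣ + c)                       ≡⟨ shrink-K c v∈ ⟩
      suc (K + (∣ Us - v ∣ + c))             ∎)
      where
      a : ℕ
      a = ∣ (Us - v) ∩ High t y ∣
      none-high : a ≡ 0
      none-high = empty⇒∣p∣≡0 _ λ w w∈ →
        let w∈U , w∈H = x∈p∩q⁻ (Us - v) (High t y) w∈ in y≰tv (≤-trans (∈High⁻ t y w∈H) (maximal w w∈U))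

    budget-deferred : ∀ {Us Ss c v} → v ∈ Us → (∀ u → u ∈ Us - v → t u ≤ t v) →
      Budget Us Ss c → Budget (Us - v) Ss c
    budget-deferred {Ss = Ss} {v = v} v∈ maximal budget y c≤y y≤ with y ≤? t v
    ... | yes y≤tv = budget-deferred-counted {Ss = Ss} v∈ budget y c≤y y≤ y≤tv
    ... | no y≰tv = budget-deferred-skipped {Ss = Ss} v∈ maximal budget y c≤y y≤ y≰tv

    budget-run : ∀ {st stf c} → Invariant st c → Budget (U st) (S st) c →
      Star TSSStep st stf → ∣ S stf ∣ ≤ K
    budget-run {st} I budget ε = budget-size {U st} {S st} budget
    budget-run {st} {c = c} I budget (step ◅ run) with classify I step
    ... | activated v v∈ _ U≡ S≡ I' = budget-run I'
      (subst₂ (λ Us Ss → Budget Us Ss (suc c)) (sym U≡) (sym S≡) (budget-activated {Ss = S st} v∈ budget)) run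
    ... | selected v v∈ high U≡ S≡ I' = budget-run I'
      (subst₂ (λ Us Ss → Budget Us Ss (suc c)) (sym U≡) (sym S≡) (budget-selected {Ss = S st} v∈ high budget)) run
    ... | deferred v v∈ _ maximal U≡ S≡ I' = budget-run I'
      (subst₂ (λ Us Ss → Budget Us Ss c) (sym U≡) (sym S≡) (budget-deferred {Ss = S st} v∈ maximal budget)) run

    TSS-upperBound : ∀ {stf} → Star TSSStep (initState (clique n) t) stf → ∣ S stf ∣ ≤ K
    TSS-upperBound = budget-run invariant-init budget-init

  -- Every output of TSS is a target set: going backwards along the run, the
  -- remaining vertices become active once enough removed vertices are active.
  module Reachability (Sf : Subset n) where
    open Activation (clique n) t Sf

    Reach : Subset n → ℕ → Set
    Reach Us c = ∀ ℓ → c ≤ ∣ A ℓ ∩ ∁ Us ∣ → ∃ λ ℓ' → Us ⊆ A ℓ'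

    private
      ∁-remove : ∀ {Us : Subset n} {v w} → w ∈ ∁ Us → w ∈ ∁ (Us - v)
      ∁-remove w∈∁ = x∉p⇒x∈∁p (λ w∈U-v → x∈∁p⇒x∉p w∈∁ (proj₁ (∈-remove⁻ w∈U-v)))

      ∁-≢ : ∀ {Us : Subset n} {v w} → v ∈ Us → w ∈ ∁ Us → w ≢ v
      ∁-≢ v∈ w∈∁ refl = x∈∁p⇒x∉p w∈∁ v∈

    grow : ∀ {Us : Subset n} {v ℓ ℓ₁} → v ∈ Us → ℓ ≤ ℓ₁ → v ∈ A ℓ₁ →
           suc ∣ A ℓ ∩ ∁ Us ∣ ≤ ∣ A ℓ₁ ∩ ∁ (Us - v) ∣
    grow {Us} {v} {ℓ} {ℓ₁} v∈ ℓ≤ℓ₁ v∈A = ≤-trans (s≤s (p⊆q⇒∣p∣≤∣q∣ old⊆)) (≤-reflexive (sym (∣p∣≡1+∣p-x∣ v∈new)))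
      where
      v∈new : v ∈ A ℓ₁ ∩ ∁ (Us - v)
      v∈new = x∈p∩q⁺ (v∈A , x∉p⇒x∈∁p (λ v∈U-v → proj₂ (∈-remove⁻ v∈U-v) refl))
      old⊆ : A ℓ ∩ ∁ Us ⊆ (A ℓ₁ ∩ ∁ (Us - v)) - v
      old⊆ w∈ = let w∈A , w∈∁ = x∈p∩q⁻ (A ℓ) (∁ Us) w∈ in
        x∈p∧x≢y⇒x∈p-y (x∈p∩q⁺ (A-mono ℓ≤ℓ₁ w∈A , ∁-remove w∈∁)) (∁-≢ v∈ w∈∁)

    extend : ∀ {Us : Subset n} {v ℓ₁} → v ∈ A ℓ₁ → (∃ λ ℓ₂ → Us - v ⊆ A ℓ₂) → ∃ λ ℓ' → Us ⊆ A ℓ'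
    extend {Us} {v} {ℓ₁} v∈A (ℓ₂ , rest) = ℓ₂ + ℓ₁ , all
      where
      all : Us ⊆ A (ℓ₂ + ℓ₁)
      all {u} u∈ with u ≟ᶠ v
      ... | yes refl = A-mono (m≤n+m ℓ₁ ℓ₂) v∈A
      ... | no u≢v = A-mono (m≤m+n ℓ₂ ℓ₁) (rest (x∈p∧x≢y⇒x∈p-y u∈ u≢v))

    -- Case 1: v sees the c active removed vertices, which meet its threshold.
    reach-activated : ∀ {Us c v} → v ∈ Us → t v ≤ c → Reach (Us - v) (suc c) → Reach Us c
    reach-activated {Us} {c} {v} v∈ tv≤c reach ℓ enough =
      extend {ℓ₁ = suc ℓ} v∈A (reach (suc ℓ) (≤-trans (s≤s enough) (grow {ℓ = ℓ} v∈ (n≤1+n ℓ) v∈A)))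
      where
      outside⊆ : A ℓ ∩ ∁ Us ⊆ clique n v ∩ A ℓ
      outside⊆ w∈ = let w∈A , w∈∁ = x∈p∩q⁻ (A ℓ) (∁ Us) w∈ in x∈p∩q⁺ (∈-clique⁺ (∁-≢ v∈ w∈∁) , w∈A)
      v∈A : v ∈ A (suc ℓ)
      v∈A = A-step ℓ v (≤-trans tv≤c (≤-trans enough (p⊆q⇒∣p∣≤∣q∣ outside⊆)))

    -- Case 2: v belongs to the output, so it is active from the start.
    reach-selected : ∀ {Us c v} → v ∈ Us → v ∈ Sf → Reach (Us - v) (suc c) → Reach Us c
    reach-selected {v = v} v∈ v∈Sf reach ℓ enough =
      extend {ℓ₁ = ℓ} v∈A (reach ℓ (≤-trans (s≤s enough) (grow {ℓ = ℓ} v∈ ≤-refl v∈A)))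
      where
      v∈A : v ∈ A ℓ
      v∈A = A-mono {0} {ℓ} z≤n v∈Sf

    -- Case 3: once the other remaining vertices are active, v sees them and
    -- the c active removed vertices, |Us| − 1 + c > t v − 1 in total.
    deferred-activates : ∀ {Us c v ℓ ℓ'} → v ∈ Us → t v < ∣ Us ∣ + c →
      c ≤ ∣ A ℓ ∩ ∁ Us ∣ → Us - v ⊆ A ℓ' → v ∈ A (suc (ℓ' + ℓ))
    deferred-activates {Us} {c} {v} {ℓ} {ℓ'} v∈ tv< enough rest = A-step L v (begin
      t v                                   ≤⟨ ≤-pred (subst (suc (t v) ≤_) (cong (_+ c) (∣p∣≡1+∣p-x∣ v∈)) tv<) ⟩
      (∣ Us - v ∣) + c                       ≤⟨ +-mono-≤ (p⊆q⇒∣p∣≤∣q∣ inside⊆) (≤-trans enough (p⊆q⇒∣p∣≤∣q∣ outside⊆)) ⟩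
      (∣ P ∩ Us ∣) + (∣ P ∩ ∁ Us ∣)          ≡⟨ ∣p∣≡∣p∩q∣+∣p∩∁q∣ P Us ⟨
      (∣ P ∣)                               ∎)
      where
      L : ℕ
      L = ℓ' + ℓ
      P : Subset n
      P = clique n v ∩ A L
      inside⊆ : Us - v ⊆ P ∩ Us
      inside⊆ w∈ = let w∈U , w≢v = ∈-remove⁻ w∈ in
        x∈p∩q⁺ (x∈p∩q⁺ (∈-clique⁺ w≢v , A-mono (m≤m+n ℓ' ℓ) (rest w∈)) , w∈U)
      outside⊆ : A ℓ ∩ ∁ Us ⊆ P ∩ ∁ Us
      outside⊆ w∈ = let w∈A , w∈∁ = x∈p∩q⁻ (A ℓ) (∁ Us) w∈ in
        x∈p∩q⁺ (x∈p∩q⁺ (∈-clique⁺ (∁-≢ v∈ w∈∁) , A-mono (m≤n+m ℓ ℓ') w∈A) , w∈∁)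

    reach-deferred : ∀ {Us c v} → v ∈ Us → t v < ∣ Us ∣ + c → Reach (Us - v) c → Reach Us c
    reach-deferred {Us} {c} {v} v∈ tv< reach ℓ enough with reach ℓ (≤-trans enough (p⊆q⇒∣p∣≤∣q∣ outside⊆))
      where
      outside⊆ : A ℓ ∩ ∁ Us ⊆ A ℓ ∩ ∁ (Us - v)
      outside⊆ w∈ = let w∈A , w∈∁ = x∈p∩q⁻ (A ℓ) (∁ Us) w∈ in x∈p∩q⁺ (w∈A , ∁-remove w∈∁)
    ... | ℓ' , rest = extend {ℓ₁ = suc (ℓ' + ℓ)} (deferred-activates {ℓ = ℓ} {ℓ' = ℓ'} v∈ tv< enough rest) (ℓ' , rest)

    reach-run : ∀ {st stf c} → Invariant st c → Star TSSStep st stf →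
      (∀ v → v ∉ U stf) → S stf ⊆ Sf → Reach (U st) c
    reach-run I ε finished _ ℓ _ = 0 , λ {u} u∈ → contradiction u∈ (finished u)
    reach-run {c = c} I (step ◅ run) finished S⊆ with classify I step
    ... | activated v v∈ tv≤c U≡ _ I' =
      reach-activated v∈ tv≤c (subst (λ Us → Reach Us (suc c)) U≡ (reach-run I' run finished S⊆))
    ... | selected v v∈ _ U≡ S≡ I' =
      reach-selected v∈ (S⊆ (S-mono run (subst (v ∈_) (sym S≡) (x∈p∪q⁺ (inj₂ (x∈⁅x⁆ v))))))
        (subst (λ Us → Reach Us (suc c)) U≡ (reach-run I' run finished S⊆))
    ... | deferred v v∈ tv< _ U≡ _ I' =
      reach-deferred v∈ tv< (subst (λ Us → Reach Us c) U≡ (reach-run I' run finished S⊆))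

  TSS-target : ∀ {stf} → Star TSSStep (initState (clique n) t) stf → (∀ v → v ∉ U stf) →
    IsTargetSet (clique n) t (S stf)
  TSS-target {stf} run finished with Reachability.reach-run (S stf) invariant-init run finished id 0 z≤n
  ... | ℓ , ⊤⊆A = ℓ , ⊆-antisym ⊆⊤ (λ _ → ⊤⊆A ∈⊤)

module Formula (n : ℕ) (t : Fin n → ℕ) (m : ℕ) (m≤n : m ≤ n)
  (sorted : ∀ i j → toℕ i ≤ toℕ j → t i ≤ t j)
  (low : ∀ i → toℕ i < n ∸ m → t i < n)
  (high : ∀ i → n ∸ m ≤ toℕ i → n ≤ t i) where

  excess : Fin n → ℕ
  excess i = if suc (toℕ i) ≤ᵇ n ∸ m then t i ∸ m ∸ toℕ i else 0

  F : ℕ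
  F = foldr _⊔_ 0 (map excess (allFin n))

  excess-cases : ∀ i → (toℕ i < n ∸ m × excess i ≡ t i ∸ m ∸ toℕ i) ⊎ excess i ≡ 0
  excess-cases i with suc (toℕ i) ≤ᵇ n ∸ m in eq
  ... | true = inj₁ (≤ᵇ⇒≤ (suc (toℕ i)) (n ∸ m) (Equivalence.from T-≡ eq) , refl)
  ... | false = inj₂ refl

  excess≡ : ∀ i → toℕ i < n ∸ m → excess i ≡ t i ∸ m ∸ toℕ i
  excess≡ i i< with suc (toℕ i) ≤ᵇ n ∸ m | ≤⇒≤ᵇ i<
  ... | true | _ = refl

  -- Lower bound: a target set contains the m vertices of threshold ≥ n, and
  -- for i < n − m the suffix u_i, …, u_{n−1} forces t(u_i) − i ≤ |S'|.
  formula-lowerBound : ∀ S' → IsTargetSet (clique n) t S' → m + F ≤ ∣ S' ∣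
  formula-lowerBound S' target = begin
    m + F             ≤⟨ +-monoʳ-≤ m (fold⊔-lub excess (allFin n) (∣ S' ∣ ∸ m) excess≤) ⟩
    m + (∣ S' ∣ ∸ m)   ≡⟨ m+[n∸m]≡n m≤S' ⟩
    (∣ S' ∣)           ∎
    where
    open LowerBound (clique n) t S'

    m≤S' : m ≤ ∣ S' ∣
    m≤S' = +-cancelˡ-≤ n m (∣ S' ∣) (subst (n + m ≤_) (+-comm (∣ S' ∣) n) n+m≤)
      where
      n+m≤ : n + m ≤ ∣ S' ∣ + n
      n+m≤ = subst (λ b → n + b ≤ ∣ S' ∣ + n) (trans (∣atLeast∣ n (n ∸ m)) (m∸[m∸n]≡n m≤n))
        (targetSet-lowerBound n (atLeast n (n ∸ m)) (λ u u∈ → high u (∈atLeast⁻ n (n ∸ m) u u∈)) target ≤-refl)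

    t∸i≤S' : ∀ i → toℕ i < n ∸ m → t i ∸ toℕ i ≤ ∣ S' ∣
    t∸i≤S' i i< = ∸-≤-shift (<⇒≤ (toℕ<n i)) (subst (λ b → t i + b ≤ ∣ S' ∣ + n) (∣atLeast∣ n (toℕ i))
      (targetSet-lowerBound (t i) (atLeast n (toℕ i)) (λ u u∈ → sorted i u (∈atLeast⁻ n (toℕ i) u u∈))
                            target (<⇒≤ (low i i<))))

    excess≤ : ∀ i → excess i ≤ ∣ S' ∣ ∸ m
    excess≤ i with excess-cases i
    ... | inj₁ (i< , e≡) = subst (_≤ ∣ S' ∣ ∸ m) (trans (∸-swap (t i) (toℕ i) m) (sym e≡)) (∸-monoˡ-≤ m (t∸i≤S' i i<))
    ... | inj₂ e≡0 = subst (_≤ ∣ S' ∣ ∸ m) (sym e≡0) z≤n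

  -- If |High y| = b > m then, High y being upward closed, it contains the
  -- index i = n − b < n − m, whose excess term bounds y − i.
  formula-upperBound : ∀ y → y ≤ n → y + ∣ High t y ∣ ≤ (m + F) + n
  formula-upperBound y y≤n with ∣ High t y ∣ ≤? m
  ... | yes few = begin
    y + (∣ High t y ∣)  ≤⟨ +-mono-≤ y≤n few ⟩
    n + m              ≤⟨ +-monoʳ-≤ n (m≤m+n m F) ⟩
    n + (m + F)        ≡⟨ +-comm n (m + F) ⟩
    m + F + n          ∎
  ... | no many = begin
    y + b                  ≤⟨ +-monoˡ-≤ b (∈High⁻ t y i∈High) ⟩
    t i + b                ≡⟨ cong (t i +_) n∸i≡b ⟨
    t i + (n ∸ toℕ i)      ≤⟨ +∸-≤-shift (t i) (<⇒≤ (toℕ<n i)) ⟩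
    t i ∸ toℕ i + n        ≤⟨ +-monoˡ-≤ n t∸i≤ ⟩
    m + F + n              ∎
    where
    b : ℕ
    b = ∣ High t y ∣
    b≤n : b ≤ n
    b≤n = ∣p∣≤n (High t y)
    m<b : m < b
    m<b = ≰⇒> many
    n∸b<n : n ∸ b < n
    n∸b<n = ∸-monoʳ-< (≤-<-trans z≤n m<b) b≤n
    i : Fin n
    i = fromℕ< n∸b<n
    n∸i≡b : n ∸ toℕ i ≡ b
    n∸i≡b = trans (cong (n ∸_) (toℕ-fromℕ< n∸b<n)) (m∸[m∸n]≡n b≤n)
    i<n∸m : toℕ i < n ∸ m
    i<n∸m = subst (_< n ∸ m) (sym (toℕ-fromℕ< n∸b<n)) (∸-monoʳ-< m<b b≤n)
    upward : ∀ j j' → toℕ j ≤ toℕ j' → j ∈ High t y → j' ∈ High t y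
    upward j j' j≤j' j∈ = ∈High⁺ t y (≤-trans (∈High⁻ t y j∈) (sorted j j' j≤j'))
    i∈High : i ∈ High t y
    i∈High = upClosed-∋ (High t y) upward i (≤-reflexive n∸i≡b)
    t∸i≤ : t i ∸ toℕ i ≤ m + F
    t∸i≤ = begin
      t i ∸ toℕ i               ≤⟨ m≤n+m∸n (t i ∸ toℕ i) m ⟩
      m + (t i ∸ toℕ i ∸ m)     ≡⟨ cong (m +_) (trans (∸-swap (t i) (toℕ i) m) (sym (excess≡ i i<n∸m))) ⟩
      m + excess i              ≤⟨ +-monoʳ-≤ m (fold⊔-ub excess (allFin n) (∈-allFin i)) ⟩
      m + F                     ∎

theorem5 : (n : ℕ) (t : Fin n → ℕ) (m : ℕ) → m ≤ n →
    (∀ i j → toℕ i ≤ toℕ j → t i ≤ t j) →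
    (∀ i → toℕ i < n ∸ m → t i < n) →
    (∀ i → n ∸ m ≤ toℕ i → n ≤ t i) →
    (S : Subset n) → TSSOutput (clique n) t S →
    IsOptimalTargetSet (clique n) t S × ∣ S ∣ ≡ cliqueBound n t m
theorem5 n t m m≤n sorted low high out (st , run , finished , S≡out) =
  subst (λ X → IsOptimalTargetSet (clique n) t X × ∣ X ∣ ≡ cliqueBound n t m) S≡out
    ( (target , λ S' target' → ≤-trans size≤ (formula-lowerBound S' target'))
    , ≤-antisym size≤ (formula-lowerBound (S st) target))
  where
  open CliqueRun n t
  open Formula n t m m≤n sorted low high

  target : IsTargetSet (clique n) t (S st)
  target = TSS-target run finished

  size≤ : ∣ S st ∣ ≤ m + F
  size≤ = UpperBound.TSS-upperBound (m + F) formula-upperBound run
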